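{- For a passable fork $G$, the following are equivalent: (a) $G$ is sente pivoting; (b) $\top\leq G\mathbin{+_j}\{a,b\mid a\}$; (c) $\{a\mid a,b\}\leq G$.
   Context: $P_2=\{\bot,a,b,\top\}$ is ordered by $\bot<a,b<\top$ with $a,b$ incomparable; a fork is any game form over $P_2$. Game forms: atomic $[x]$ (written $x$) or composite $\{L\mid R\}$ with $L,R$ nonempty sets of game forms; atomic games have no options. $K^{(L)}$ is a left option of $K$ if $K$ is composite, $K$ itself if atomic; similarly $K^{(R)}$. Mutually recursively: $G\leq H$ iff every $G^{(L)}\lhd H$ and $G\lhd H^{(R)}$ for every $H^{(R)}$; $G\lhd H$ iff some $G^R\leq H$, or some $H^L$ has $G\leq H^L$, or both atomic $[x],[y]$ with $x\leq y$. $G$ is passable if $G\lhd G$ and recursively all options are passable. A fork $G$ is sente pivoting if $a\lhd G$ and for every right option $G^R$ of $G$, either $b\leq G^R$ or there exists some $G^{R(L)}$ that is sente pivoting. Sum: for monotone $f:A\times B\to C$, $G+_fH=\{G^L+_fH,\,G+_fH^L\mid G^R+_fH,\,G+_fH^R\}$ if one of $G,H$ is composite, $[x]+_f[y]=[f(x,y)]$. Juxtaposition $+_j$ of forks is the sum with $f:P_2\times P_2\to\{\bot<\top\}$, $f(x,y)=\top$ iff $x,y\neq\bot$ and $\{x,y\}\neq\{a,b\}$. -}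

module Defs where

open import Data.Nat using (ℕ; suc; _+_)
open import Data.Fin using (Fin; zero; suc; splitAt)
open import Data.Sum using (_⊎_; inj₁; inj₂; [_,_]′)
open import Data.Product using (Σ; _×_; _,_)
open import Data.Unit using (⊤; tt)
open import Data.Empty renaming (⊥ to Empty)

data Game (A : Set) : Set where
  atom : A → Game A
  comp : {n m : ℕ} → (Fin (suc n) → Game A) → (Fin (suc m) → Game A) → Game A

-- The relations ≤ and ◁ (relative to an order on the carrier).
-- Cases are written out using the convention K^(L) = K^(R) = K for
-- atomic K, and that atomic games have no (genuine) options.

module Order {A : Set} (_≤A_ : A → A → Set) where

  mutual
    _≤G_ : Game A → Game A → Set
    atom x ≤G atom y = (atom x ◁ atom y) × (atom x ◁ atom y)
    atom x ≤G comp L R = (atom x ◁ comp L R) × (∀ j → atom x ◁ R j)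
    comp L R ≤G atom y = (∀ i → L i ◁ atom y) × (comp L R ◁ atom y)
    comp L R ≤G comp L' R' = (∀ i → L i ◁ comp L' R') × (∀ j → comp L R ◁ R' j)

    _◁_ : Game A → Game A → Set
    atom x ◁ atom y = x ≤A y
    atom x ◁ comp L R = Σ _ λ i → atom x ≤G L i
    comp L R ◁ atom y = Σ _ λ j → R j ≤G atom y
    comp L R ◁ comp L' R' =
      (Σ _ λ j → R j ≤G comp L' R') ⊎ (Σ _ λ i → comp L R ≤G L' i)

  Passable : Game A → Set
  Passable (atom x) = atom x ◁ atom x
  Passable (comp L R) =
    (comp L R ◁ comp L R) × (∀ i → Passable (L i)) × (∀ j → Passable (R j))

append : {X : Set} {n m : ℕ} → (Fin (suc n) → X) → (Fin (suc m) → X) →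
         Fin (suc n + suc m) → X
append {n = n} f g i = [ f , g ]′ (splitAt (suc n) i)

module Sum {A B C : Set} (f : A → B → C) where

  _⊕_ : Game A → Game B → Game C
  atom x ⊕ atom y = atom (f x y)
  atom x ⊕ comp L R = comp (λ i → atom x ⊕ L i) (λ j → atom x ⊕ R j)
  comp L R ⊕ atom y = comp (λ i → L i ⊕ atom y) (λ j → R j ⊕ atom y)
  G@(comp L R) ⊕ H@(comp L' R') =
    comp (append (λ i → L i ⊕ H) (λ i → G ⊕ L' i))
         (append (λ j → R j ⊕ H) (λ j → G ⊕ R' j))

data P₂ : Set where
  bot a b top : P₂

_≤P_ : P₂ → P₂ → Set
bot ≤P _   = ⊤
a   ≤P a   = ⊤
a   ≤P top = ⊤
b   ≤P b   = ⊤
b   ≤P top = ⊤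
top ≤P top = ⊤
_   ≤P _   = Empty

data Two : Set where
  bot₂ top₂ : Two

_≤T_ : Two → Two → Set
bot₂ ≤T _    = ⊤
top₂ ≤T top₂ = ⊤
top₂ ≤T bot₂ = Empty

Fork : Set
Fork = Game P₂

open Order _≤P_ public renaming (_≤G_ to _≤F_; _◁_ to _◁F_; Passable to PassableF)
open Order _≤T_ public using () renaming (_≤G_ to _≤₂_)

j : P₂ → P₂ → Two
j bot _ = bot₂
j _ bot = bot₂
j a b = bot₂
j b a = bot₂
j _ _ = top₂

open Sum j public using () renaming (_⊕_ to _+j_)

mutual
  SentePivoting : Fork → Set
  SentePivoting (atom x) = atom a ◁F atom x
  SentePivoting (comp L R) =
    (atom a ◁F comp L R) × (∀ k → (atom b ≤F R k) ⊎ SPLeftOpt (R k))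

  SPLeftOpt : Fork → Set
  SPLeftOpt (atom x) = SentePivoting (atom x)
  SPLeftOpt (comp L R) = Σ _ λ i → SentePivoting (L i)

two : {X : Set} → X → X → Fin 2 → X
two x y zero = x
two x y (suc _) = y

one : {X : Set} → X → Fin 1 → X
one x _ = x

abOverA : Fork
abOverA = comp (two (atom a) (atom b)) (one (atom a))

aOverAB : Fork
aOverAB = comp (one (atom a)) (two (atom a) (atom b))

-- Both (b) and (c) unfold, one move at a time,
-- into the clauses of sente pivoting.  In (c), the left option a of {a | a,b}
-- gives a ◁ G, and against a right option G^R Left must answer either with b
-- (b ≤ G^R) or with a left option of G^R, which is again sente pivoting.  In
-- (b), Right's reply G +j a and Left's replies G^R +j a, G^R +j b play the same
-- roles, because juxtaposing with an atom y ∈ {a, b} turns y ≤ K into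
-- ⊤ ≤ K +j y.  Finally a ≤ K alone already makes K sente pivoting.
module Submission where

open import Defs
open import Data.Product using (_×_)
open import Function.Bundles using (_⇔_)

open import Data.Nat using (ℕ; suc)
open import Data.Fin using (Fin; zero; suc; splitAt; _↑ˡ_; _↑ʳ_)
open import Data.Fin.Properties using (splitAt-↑ˡ; splitAt-↑ʳ)
open import Data.Sum using (_⊎_; inj₁; inj₂; [_,_]′)
open import Data.Product using (∃; _,_; proj₁)
open import Data.Unit using (tt)
open import Relation.Binary.PropositionalEquality using (_≡_; cong; subst; sym)
open import Function.Bundles using (mk⇔)

open Order _≤T_ using () renaming (_◁_ to _◁₂_)

module _ {X : Set} {n m : ℕ} (f : Fin (suc n) → X) (g : Fin (suc m) → X) where

  append-↑ˡ : ∀ i → append f g (i ↑ˡ suc m) ≡ f i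
  append-↑ˡ i = cong [ f , g ]′ (splitAt-↑ˡ (suc n) i (suc m))

  append-↑ʳ : ∀ i → append f g (suc n ↑ʳ i) ≡ g i
  append-↑ʳ i = cong [ f , g ]′ (splitAt-↑ʳ (suc n) (suc m) i)

  module _ (P : X → Set) where

    append-∀ : (∀ i → P (f i)) → (∀ i → P (g i)) → ∀ k → P (append f g k)
    append-∀ pf pg k with splitAt (suc n) k
    ... | inj₁ i = pf i
    ... | inj₂ i = pg i

    append-∃ : ∀ k → P (append f g k) → (∃ λ i → P (f i)) ⊎ (∃ λ i → P (g i))
    append-∃ k p with splitAt (suc n) k
    ... | inj₁ i = inj₁ (i , p)
    ... | inj₂ i = inj₂ (i , p)

module SumOfComposites {A B C : Set} (_≤C_ : C → C → Set) (f : A → B → C) where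
  open Order _≤C_
  open Sum f

  module _ {n m n′ m′ : ℕ} {L : Fin (suc n) → Game A} {R : Fin (suc m) → Game A}
           {L′ : Fin (suc n′) → Game B} {R′ : Fin (suc m′) → Game B} (c : C) where

    private
      G = comp L R
      H = comp L′ R′

    atom◁⊕-introˡ : ∀ i → atom c ≤G (L i ⊕ H) → atom c ◁ (G ⊕ H)
    atom◁⊕-introˡ i p =
      i ↑ˡ suc n′ , subst (atom c ≤G_) (sym (append-↑ˡ (λ i → L i ⊕ H) (λ i → G ⊕ L′ i) i)) p

    atom◁⊕-introʳ : ∀ i → atom c ≤G (G ⊕ L′ i) → atom c ◁ (G ⊕ H)
    atom◁⊕-introʳ i p =
      suc n ↑ʳ i , subst (atom c ≤G_) (sym (append-↑ʳ (λ i → L i ⊕ H) (λ i → G ⊕ L′ i) i)) p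

    atom◁⊕-elim : atom c ◁ (G ⊕ H) →
      (∃ λ i → atom c ≤G (L i ⊕ H)) ⊎ (∃ λ i → atom c ≤G (G ⊕ L′ i))
    atom◁⊕-elim (k , p) = append-∃ (λ i → L i ⊕ H) (λ i → G ⊕ L′ i) (atom c ≤G_) k p

    atom≤⊕-intro : atom c ◁ (G ⊕ H) →
      (∀ k → atom c ◁ (R k ⊕ H)) → (∀ k → atom c ◁ (G ⊕ R′ k)) → atom c ≤G (G ⊕ H)
    atom≤⊕-intro p pR pR′ = p , append-∀ (λ k → R k ⊕ H) (λ k → G ⊕ R′ k) (atom c ◁_) pR pR′

    atom≤⊕-elim : atom c ≤G (G ⊕ H) →
      (∀ k → atom c ◁ (R k ⊕ H)) × (∀ k → atom c ◁ (G ⊕ R′ k))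
    atom≤⊕-elim (_ , p) =
      (λ k → subst (atom c ◁_) (append-↑ˡ (λ k → R k ⊕ H) (λ k → G ⊕ R′ k) k) (p (k ↑ˡ suc m′))) ,
      (λ k → subst (atom c ◁_) (append-↑ʳ (λ k → R k ⊕ H) (λ k → G ⊕ R′ k) k) (p (suc m ↑ʳ k)))

module AtomShift {A B C : Set} (_≤A_ : A → A → Set) (_≤C_ : C → C → Set)
                 (f : A → B → C) (y : A) (z : B) (c : C)
                 (shift : ∀ x → y ≤A x → c ≤C f x z)
                 (unshift : ∀ x → c ≤C f x z → y ≤A x) where
  open Order _≤A_ renaming (_≤G_ to _≤ᴬ_; _◁_ to _◁ᴬ_)
  open Order _≤C_ renaming (_≤G_ to _≤ᶜ_; _◁_ to _◁ᶜ_)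
  open Sum f

  mutual
    atom≤⇒atom≤⊕atom : ∀ G → atom y ≤ᴬ G → atom c ≤ᶜ (G ⊕ atom z)
    atom≤⇒atom≤⊕atom (atom x) (p , _) = shift x p , shift x p
    atom≤⇒atom≤⊕atom (comp L R) ((i , p) , pR) =
      (i , atom≤⇒atom≤⊕atom (L i) p) , λ k → atom◁⇒atom◁⊕atom (R k) (pR k)

    atom◁⇒atom◁⊕atom : ∀ G → atom y ◁ᴬ G → atom c ◁ᶜ (G ⊕ atom z)
    atom◁⇒atom◁⊕atom (atom x) p = shift x p
    atom◁⇒atom◁⊕atom (comp L R) (i , p) = i , atom≤⇒atom≤⊕atom (L i) p

  mutual
    atom≤⊕atom⇒atom≤ : ∀ G → atom c ≤ᶜ (G ⊕ atom z) → atom y ≤ᴬ G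
    atom≤⊕atom⇒atom≤ (atom x) (p , _) = unshift x p , unshift x p
    atom≤⊕atom⇒atom≤ (comp L R) ((i , p) , pR) =
      (i , atom≤⊕atom⇒atom≤ (L i) p) , λ k → atom◁⊕atom⇒atom◁ (R k) (pR k)

    atom◁⊕atom⇒atom◁ : ∀ G → atom c ◁ᶜ (G ⊕ atom z) → atom y ◁ᴬ G
    atom◁⊕atom⇒atom◁ (atom x) p = unshift x p
    atom◁⊕atom⇒atom◁ (comp L R) (i , p) = i , atom≤⊕atom⇒atom≤ (L i) p

a≤⇒top≤j·a : ∀ x → a ≤P x → top₂ ≤T j x a
a≤⇒top≤j·a a _ = tt
a≤⇒top≤j·a top _ = tt

top≤j·a⇒a≤ : ∀ x → top₂ ≤T j x a → a ≤P x
top≤j·a⇒a≤ a _ = tt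
top≤j·a⇒a≤ top _ = tt

b≤⇒top≤j·b : ∀ x → b ≤P x → top₂ ≤T j x b
b≤⇒top≤j·b b _ = tt
b≤⇒top≤j·b top _ = tt

top≤j·b⇒b≤ : ∀ x → top₂ ≤T j x b → b ≤P x
top≤j·b⇒b≤ b _ = tt
top≤j·b⇒b≤ top _ = tt

module ShiftA = AtomShift _≤P_ _≤T_ j a a top₂ a≤⇒top≤j·a top≤j·a⇒a≤
module ShiftB = AtomShift _≤P_ _≤T_ j b b top₂ b≤⇒top≤j·b top≤j·b⇒b≤
open SumOfComposites _≤T_ j

SenteReply : Fork → Set
SenteReply K = (atom b ≤F K) ⊎ SPLeftOpt K

mutual
  a≤⇒SentePivoting : ∀ K → atom a ≤F K → SentePivoting K
  a≤⇒SentePivoting (atom x) (p , _) = p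
  a≤⇒SentePivoting (comp L R) (p , pR) = p , λ k → inj₂ (a◁⇒SPLeftOpt (R k) (pR k))

  a◁⇒SPLeftOpt : ∀ K → atom a ◁F K → SPLeftOpt K
  a◁⇒SPLeftOpt (atom x) p = p
  a◁⇒SPLeftOpt (comp L R) (i , p) = i , a≤⇒SentePivoting (L i) p

mutual
  SentePivoting⇒top≤+jabOverA : ∀ G → SentePivoting G → atom top₂ ≤₂ (G +j abOverA)
  SentePivoting⇒top≤+jabOverA (atom x) p =
    (zero , a≤⇒top≤j·a x p , a≤⇒top≤j·a x p) , λ _ → a≤⇒top≤j·a x p
  SentePivoting⇒top≤+jabOverA G@(comp L R) ((i , a≤Lᵢ) , replies) =
    atom≤⊕-intro top₂
      (atom◁⊕-introˡ top₂ i
        (SentePivoting⇒top≤+jabOverA (L i) (a≤⇒SentePivoting (L i) a≤Lᵢ)))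
      (λ k → SenteReply⇒top◁+jabOverA (R k) (replies k))
      (λ _ → ShiftA.atom◁⇒atom◁⊕atom G (i , a≤Lᵢ))

  SenteReply⇒top◁+jabOverA : ∀ K → SenteReply K → atom top₂ ◁₂ (K +j abOverA)
  SenteReply⇒top◁+jabOverA (atom y) (inj₁ (p , _)) =
    suc zero , b≤⇒top≤j·b y p , b≤⇒top≤j·b y p
  SenteReply⇒top◁+jabOverA (atom y) (inj₂ p) =
    zero , a≤⇒top≤j·a y p , a≤⇒top≤j·a y p
  SenteReply⇒top◁+jabOverA K@(comp L R) (inj₁ b≤K) =
    atom◁⊕-introʳ top₂ (suc zero) (ShiftB.atom≤⇒atom≤⊕atom K b≤K)
  SenteReply⇒top◁+jabOverA (comp L R) (inj₂ (i , p)) =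
    atom◁⊕-introˡ top₂ i (SentePivoting⇒top≤+jabOverA (L i) p)

mutual
  top≤+jabOverA⇒SentePivoting : ∀ G → atom top₂ ≤₂ (G +j abOverA) → SentePivoting G
  top≤+jabOverA⇒SentePivoting (atom x) (_ , p) = top≤j·a⇒a≤ x (p zero)
  top≤+jabOverA⇒SentePivoting G@(comp L R) p with atom≤⊕-elim top₂ p
  ... | pR , pa = ShiftA.atom◁⊕atom⇒atom◁ G (pa zero) ,
                  λ k → top◁+jabOverA⇒SenteReply (R k) (pR k)

  top◁+jabOverA⇒SenteReply : ∀ K → atom top₂ ◁₂ (K +j abOverA) → SenteReply K
  top◁+jabOverA⇒SenteReply (atom y) (zero , p , _) = inj₂ (top≤j·a⇒a≤ y p)
  top◁+jabOverA⇒SenteReply (atom y) (suc zero , p , _) =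
    inj₁ (top≤j·b⇒b≤ y p , top≤j·b⇒b≤ y p)
  top◁+jabOverA⇒SenteReply K@(comp L R) p with atom◁⊕-elim top₂ p
  ... | inj₁ (i , q) = inj₂ (i , top≤+jabOverA⇒SentePivoting (L i) q)
  ... | inj₂ (zero , q) = inj₂ (a◁⇒SPLeftOpt K (proj₁ (ShiftA.atom≤⊕atom⇒atom≤ K q)))
  ... | inj₂ (suc zero , q) = inj₁ (ShiftB.atom≤⊕atom⇒atom≤ K q)

mutual
  SentePivoting⇒aOverAB≤ : ∀ G → SentePivoting G → aOverAB ≤F G
  SentePivoting⇒aOverAB≤ (atom x) p = (λ _ → p) , zero , p , p
  SentePivoting⇒aOverAB≤ (comp L R) (p , replies) =
    (λ _ → p) , λ k → SenteReply⇒aOverAB◁ (R k) (replies k)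

  SenteReply⇒aOverAB◁ : ∀ K → SenteReply K → aOverAB ◁F K
  SenteReply⇒aOverAB◁ (atom y) (inj₁ (p , _)) = suc zero , p , p
  SenteReply⇒aOverAB◁ (atom y) (inj₂ p) = zero , p , p
  SenteReply⇒aOverAB◁ (comp L R) (inj₁ p) = inj₁ (suc zero , p)
  SenteReply⇒aOverAB◁ (comp L R) (inj₂ (i , p)) = inj₂ (i , SentePivoting⇒aOverAB≤ (L i) p)

mutual
  aOverAB≤⇒SentePivoting : ∀ G → aOverAB ≤F G → SentePivoting G
  aOverAB≤⇒SentePivoting (atom x) (pL , _) = pL zero
  aOverAB≤⇒SentePivoting (comp L R) (pL , pR) =
    pL zero , λ k → aOverAB◁⇒SenteReply (R k) (pR k)

  aOverAB◁⇒SenteReply : ∀ K → aOverAB ◁F K → SenteReply K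
  aOverAB◁⇒SenteReply (atom y) (zero , p , _) = inj₂ p
  aOverAB◁⇒SenteReply (atom y) (suc zero , p , _) = inj₁ (p , p)
  aOverAB◁⇒SenteReply K@(comp L R) (inj₁ (zero , p)) = inj₂ (a◁⇒SPLeftOpt K (proj₁ p))
  aOverAB◁⇒SenteReply (comp L R) (inj₁ (suc zero , p)) = inj₁ p
  aOverAB◁⇒SenteReply (comp L R) (inj₂ (i , p)) = inj₂ (i , aOverAB≤⇒SentePivoting (L i) p)

proposition6p5 : (G : Fork) → PassableF G →
    (SentePivoting G ⇔ (atom top₂ ≤₂ (G +j abOverA)))
    × (SentePivoting G ⇔ (aOverAB ≤F G))
proposition6p5 G _ =
  mk⇔ (SentePivoting⇒top≤+jabOverA G) (top≤+jabOverA⇒SentePivoting G) ,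
  mk⇔ (SentePivoting⇒aOverAB≤ G) (aOverAB≤⇒SentePivoting G)
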